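{- Let $n$ be a positive integer with $n\equiv 10 \pmod{12}$. Then there exists a $3$-star system of order $n$ which is $(n-1)$-block-colourable.
   Context: A $3$-star is a copy of the complete bipartite graph $K_{1,3}$. A $3$-star system of order $n$ is a pair $(V,\mathcal{B})$ where $|V|=n$ and $\mathcal{B}$ is a set of $3$-stars (subgraphs of the complete graph $K_n$ on $V$) whose edge sets partition the edge set of $K_n$; the elements of $\mathcal B$ are called blocks. A block-colouring is a partition of $\mathcal{B}$ into colour classes such that the blocks in each colour class are pairwise vertex-disjoint. The system is $k$-block-colourable if it admits a block-colouring with $k$ colour classes. -}

module Defs where

open import Data.Nat using (ℕ)
open import Data.Fin using (Fin)
open import Data.Product using (Σ; ∃; _×_; _,_)
open import Data.Sum using (_⊎_)
open import Relation.Binary.PropositionalEquality using (_≡_)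
open import Relation.Nullary using (¬_)
open import Function.Definitions using (Surjective)

record Star (n : ℕ) : Set where
  field
    centre : Fin n
    leaf₁ leaf₂ leaf₃ : Fin n
    c≢1 : ¬ centre ≡ leaf₁
    c≢2 : ¬ centre ≡ leaf₂
    c≢3 : ¬ centre ≡ leaf₃
    1≢2 : ¬ leaf₁ ≡ leaf₂
    1≢3 : ¬ leaf₁ ≡ leaf₃
    2≢3 : ¬ leaf₂ ≡ leaf₃

open Star public

VertexOf : ∀ {n} → Fin n → Star n → Set
VertexOf v s = v ≡ centre s ⊎ v ≡ leaf₁ s ⊎ v ≡ leaf₂ s ⊎ v ≡ leaf₃ s

LeafOf : ∀ {n} → Fin n → Star n → Set
LeafOf v s = v ≡ leaf₁ s ⊎ v ≡ leaf₂ s ⊎ v ≡ leaf₃ s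

EdgeOf : ∀ {n} → Fin n → Fin n → Star n → Set
EdgeOf x y s = (x ≡ centre s × LeafOf y s) ⊎ (y ≡ centre s × LeafOf x s)

IsStarSystem : (n m : ℕ) → (Fin m → Star n) → Set
IsStarSystem n m B =
  ∀ (x y : Fin n) → ¬ x ≡ y →
    Σ (Fin m) λ i → EdgeOf x y (B i) × (∀ j → EdgeOf x y (B j) → j ≡ i)

VertexDisjoint : ∀ {n} → Star n → Star n → Set
VertexDisjoint s t = ∀ v → VertexOf v s → ¬ VertexOf v t

-- A block-colouring with k colour classes: a map from blocks onto k colours
-- (surjective, so there are exactly k nonempty classes) such that distinct
-- blocks of the same colour are vertex-disjoint.
IsBlockColouring : ∀ {n m} (B : Fin m → Star n) (k : ℕ) → (Fin m → Fin k) → Set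
IsBlockColouring {n} {m} B k col =
  Surjective _≡_ _≡_ col ×
  (∀ i j → ¬ i ≡ j → col i ≡ col j → VertexDisjoint (B i) (B j))

BlockColourable : ∀ {n m} (B : Fin m → Star n) (k : ℕ) → Set
BlockColourable {m = m} B k = Σ (Fin m → Fin k) λ col → IsBlockColouring B k col

{-# OPTIONS --safe #-}
-- Write n = 6s + 4 with s = 2t + 1. The vertices are four fixed points and s groups of six
-- indexed by ℤ_s; the n − 1 colours are three special ones and the pairs (f, x) with f ∈ ℤ_s,
-- x < 6. Between groups a ≠ b the complete bipartite graph K₆,₆ is cut into twelve claws,
-- six centred on each side, all in colour class a + b. Group 0 together with the fixed points
-- carries a 9-colourable 3-star system of K₁₀; every other group g carries a decomposition of
-- K₁₀ − K₄ (group 0 already covers the K₄ on the fixed points) whose ordinary colours go to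
-- class 2g and whose only specially coloured claw avoids the fixed points. As s is odd, g ↦ 2g is
-- injective, and a + b = c + d with a common summand forces {a, b} = {c, d}; hence claws of the
-- same colour never meet.
module Submission where

open import Defs
open import Data.Bool using (Bool; true; false; not)
open import Data.Nat as ℕ using (ℕ; zero; suc; _+_; _*_; _∸_; _%_; _/_; _<_; _≤_; _>_; NonZero)
open import Data.Nat.Properties
  using (m∸n+n≡m; ≮⇒≥; ≰⇒>; <⇒≱; +-cancelʳ-<; +-cancelˡ-<; +-cancelˡ-≡; +-mono-<; +-monoʳ-<; +-comm; +-assoc;
         +-identityʳ; m+n≮n; *-cancelˡ-≡; even≢odd)
open import Data.Nat.DivMod using (m%n<n; m<n⇒m%n≡m; m≤n⇒[n∸m]%m≡n%m; m≡m%n+[m/n]*n)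
open import Data.Fin using (Fin; zero; suc; toℕ; fromℕ<; #_; splitAt; join; _↑ˡ_; _↑ʳ_; punchIn; punchOut)
open import Data.Fin.Properties
  using (_≟_; _<?_; all?; any?; <-cmp; toℕ<n; toℕ-fromℕ<; toℕ-injective; toℕ-↑ˡ; +↔⊎; *↔×; join-splitAt;
         splitAt-↑ˡ; splitAt-↑ʳ; splitAt-<; punchIn-injective; punchInᵢ≢i; punchIn-punchOut)
open import Data.Product using (Σ; ∃; ∃!; _×_; _,_; proj₁; proj₂)
open import Data.Product.Properties using (,-injectiveˡ; ,-injectiveʳ)
open import Data.Product.Function.NonDependent.Propositional using (_×-↔_)
open import Data.Sum as Sum using (_⊎_; inj₁; inj₂)
open import Data.Sum.Properties using (inj₂-injective; ≡-dec)
open import Data.Sum.Function.Propositional using (_⊎-↔_)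
open import Data.Vec using (_∷_; []; lookup)
open import Function using (_∘_)
open import Function.Bundles using (_↔_; Inverse; Injection; mk↔ₛ′)
open import Function.Construct.Composition using (_↔-∘_)
open import Function.Construct.Identity using (↔-id)
open import Function.Definitions using (Injective; StrictlySurjective)
open import Function.Consequences.Propositional using (strictlySurjective⇒surjective)
open import Function.Properties.Inverse using (↔⇒↣; ↔-sym)
open import Relation.Binary.Definitions using (DecidableEquality; tri<; tri≈; tri>)
open import Relation.Binary.PropositionalEquality
open import Relation.Nullary using (¬_; Dec; does; yes; no; map′; ¬?; contradiction)
open import Relation.Nullary.Decidable
  using (True; toWitness; from-yes; dec-true; dec-false; _×-dec_; _⊎-dec_; _→-dec_)

-- Claws on an arbitrary vertex type

record Claw (V : Set) : Set where
  constructor claw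
  field
    hub tip₁ tip₂ tip₃ : V
    hub≢tip₁ : hub ≢ tip₁
    hub≢tip₂ : hub ≢ tip₂
    hub≢tip₃ : hub ≢ tip₃
    tip₁≢tip₂ : tip₁ ≢ tip₂
    tip₁≢tip₃ : tip₁ ≢ tip₃
    tip₂≢tip₃ : tip₂ ≢ tip₃

open Claw

module _ {V : Set} where

  IsTip : V → Claw V → Set
  IsTip v c = v ≡ tip₁ c ⊎ v ≡ tip₂ c ⊎ v ≡ tip₃ c

  IsVertex : V → Claw V → Set
  IsVertex v c = v ≡ hub c ⊎ IsTip v c

  IsEdge : V → V → Claw V → Set
  IsEdge x y c = (x ≡ hub c × IsTip y c) ⊎ (y ≡ hub c × IsTip x c)

  Disjoint : Claw V → Claw V → Set
  Disjoint c d = ∀ v → IsVertex v c → ¬ IsVertex v d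

  disjoint-sym : ∀ {c d} → Disjoint c d → Disjoint d c
  disjoint-sym c∩d v v∈d v∈c = c∩d v v∈c v∈d

  isEdge-sym : ∀ c {x y} → IsEdge x y c → IsEdge y x c
  isEdge-sym c = Sum.swap

  edge-vertices : ∀ c {x y} → IsEdge x y c → IsVertex x c × IsVertex y c
  edge-vertices c (inj₁ (x≡hub , y∈tips)) = inj₁ x≡hub , inj₂ y∈tips
  edge-vertices c (inj₂ (y≡hub , x∈tips)) = inj₂ x∈tips , inj₁ y≡hub

  module _ (_≟_ : DecidableEquality V) where

    isTip? : ∀ v c → Dec (IsTip v c)
    isTip? v c = (v ≟ tip₁ c) ⊎-dec (v ≟ tip₂ c) ⊎-dec (v ≟ tip₃ c)

    isVertex? : ∀ v c → Dec (IsVertex v c)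
    isVertex? v c = (v ≟ hub c) ⊎-dec isTip? v c

    isEdge? : ∀ x y c → Dec (IsEdge x y c)
    isEdge? x y c = ((x ≟ hub c) ×-dec isTip? y c) ⊎-dec ((y ≟ hub c) ×-dec isTip? x c)

module _ {A B : Set} (f : A → B) (f-injective : Injective _≡_ _≡_ f) where

  mapClaw : Claw A → Claw B
  mapClaw c = claw (f (hub c)) (f (tip₁ c)) (f (tip₂ c)) (f (tip₃ c))
    (hub≢tip₁ c ∘ f-injective) (hub≢tip₂ c ∘ f-injective) (hub≢tip₃ c ∘ f-injective)
    (tip₁≢tip₂ c ∘ f-injective) (tip₁≢tip₃ c ∘ f-injective) (tip₂≢tip₃ c ∘ f-injective)

  isTip-map⁺ : ∀ c {v} → IsTip v c → IsTip (f v) (mapClaw c)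
  isTip-map⁺ c = Sum.map (cong f) (Sum.map (cong f) (cong f))

  isTip-map⁻ : ∀ c {v} → IsTip (f v) (mapClaw c) → IsTip v c
  isTip-map⁻ c (inj₁ fv≡) = inj₁ (f-injective fv≡)
  isTip-map⁻ c (inj₂ (inj₁ fv≡)) = inj₂ (inj₁ (f-injective fv≡))
  isTip-map⁻ c (inj₂ (inj₂ fv≡)) = inj₂ (inj₂ (f-injective fv≡))

  isVertex-map⁻ : ∀ c {v} → IsVertex (f v) (mapClaw c) → IsVertex v c
  isVertex-map⁻ c (inj₁ fv≡) = inj₁ (f-injective fv≡)
  isVertex-map⁻ c (inj₂ fv∈tips) = inj₂ (isTip-map⁻ c fv∈tips)

  isEdge-map⁺ : ∀ c {x y} → IsEdge x y c → IsEdge (f x) (f y) (mapClaw c)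
  isEdge-map⁺ c (inj₁ (x≡ , y∈tips)) = inj₁ (cong f x≡ , isTip-map⁺ c y∈tips)
  isEdge-map⁺ c (inj₂ (y≡ , x∈tips)) = inj₂ (cong f y≡ , isTip-map⁺ c x∈tips)

  isEdge-map⁻ : ∀ c {x y} → IsEdge (f x) (f y) (mapClaw c) → IsEdge x y c
  isEdge-map⁻ c (inj₁ (fx≡ , fy∈tips)) = inj₁ (f-injective fx≡ , isTip-map⁻ c fy∈tips)
  isEdge-map⁻ c (inj₂ (fy≡ , fx∈tips)) = inj₂ (f-injective fy≡ , isTip-map⁻ c fx∈tips)

  vertex-map-image : ∀ c {w} → IsVertex w (mapClaw c) → ∃ λ v → w ≡ f v
  vertex-map-image c (inj₁ w≡) = _ , w≡
  vertex-map-image c (inj₂ (inj₁ w≡)) = _ , w≡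
  vertex-map-image c (inj₂ (inj₂ (inj₁ w≡))) = _ , w≡
  vertex-map-image c (inj₂ (inj₂ (inj₂ w≡))) = _ , w≡

  disjoint-map : ∀ {c d} → Disjoint c d → Disjoint (mapClaw c) (mapClaw d)
  disjoint-map {c} {d} c∩d w w∈c w∈d with vertex-map-image c w∈c
  ... | v , refl = c∩d v (isVertex-map⁻ c w∈c) (isVertex-map⁻ d w∈d)

module _ {V I : Set} (B : I → Claw V) where

  IsClawSystem : Set
  IsClawSystem = ∀ x y → x ≢ y → ∃! _≡_ λ i → IsEdge x y (B i)

  IsClawColouring : {C : Set} → (I → C) → Set
  IsClawColouring colour =
    StrictlySurjective _≡_ colour ×
    (∀ i j → i ≢ j → colour i ≡ colour j → Disjoint (B i) (B j))

  uniqueEdge-sym : ∀ {x y} → ∃! _≡_ (λ i → IsEdge x y (B i)) → ∃! _≡_ (λ i → IsEdge y x (B i))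
  uniqueEdge-sym (i , e , unique) = i , isEdge-sym (B i) e , λ {j} → unique ∘ isEdge-sym (B j)

toStar : ∀ {n} → Claw (Fin n) → Star n
toStar c = record
  { centre = hub c ; leaf₁ = tip₁ c ; leaf₂ = tip₂ c ; leaf₃ = tip₃ c
  ; c≢1 = hub≢tip₁ c ; c≢2 = hub≢tip₂ c ; c≢3 = hub≢tip₃ c
  ; 1≢2 = tip₁≢tip₂ c ; 1≢3 = tip₁≢tip₃ c ; 2≢3 = tip₂≢tip₃ c
  }

ColourableStarSystem : ℕ → ℕ → Set
ColourableStarSystem n k =
  Σ ℕ λ m → Σ (Fin m → Star n) λ B → IsStarSystem n m B × BlockColourable B k

colourableStarSystem : ∀ {V I C : Set} {n m k} →
  V ↔ Fin n → Fin m ↔ I → C ↔ Fin k →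
  (B : I → Claw V) (colour : I → C) → IsClawSystem B → IsClawColouring B colour →
  ColourableStarSystem n k
colourableStarSystem {V} {I} {C} {n} {m} {k} ν β κ B colour system (onto , proper) =
  m , S , isSystem , colour′ , strictlySurjective⇒surjective onto′ , proper′
  where
  open Inverse
  injective : ∀ {X Y : Set} (e : X ↔ Y) → Injective _≡_ _≡_ (to e)
  injective e = Injection.injective (↔⇒↣ e)

  claw′ : I → Claw (Fin n)
  claw′ i = mapClaw (to ν) (injective ν) (B i)

  S : Fin m → Star n
  S j = toStar (claw′ (to β j))

  isSystem : IsStarSystem n m S
  isSystem x y x≢y with system (from ν x) (from ν y) (x≢y ∘ injective (↔-sym ν))
  ... | i , e , unique = from β i , edge , unique′
    where
    back : ∀ {i} → IsEdge x y (claw′ i) → IsEdge (from ν x) (from ν y) (B i)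
    back {i} e′ = isEdge-map⁻ (to ν) (injective ν) (B i)
      (subst₂ (λ x y → IsEdge x y (claw′ i)) (sym (strictlyInverseˡ ν x)) (sym (strictlyInverseˡ ν y)) e′)
    edge : IsEdge x y (claw′ (to β (from β i)))
    edge rewrite strictlyInverseˡ β i =
      subst₂ (λ x y → IsEdge x y (claw′ i)) (strictlyInverseˡ ν x) (strictlyInverseˡ ν y)
        (isEdge-map⁺ (to ν) (injective ν) (B i) e)
    unique′ : ∀ j → IsEdge x y (claw′ (to β j)) → j ≡ from β i
    unique′ j e′ = trans (sym (strictlyInverseʳ β j)) (cong (from β) (sym (unique (back e′))))

  colour′ : Fin m → Fin k
  colour′ = to κ ∘ colour ∘ to β

  onto′ : StrictlySurjective _≡_ colour′
  onto′ c with onto (from κ c)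
  ... | i , colour-i = from β i ,
    trans (cong (to κ ∘ colour) (strictlyInverseˡ β i)) (trans (cong (to κ) colour-i) (strictlyInverseˡ κ c))

  proper′ : ∀ i j → i ≢ j → colour′ i ≡ colour′ j → VertexDisjoint (S i) (S j)
  proper′ i j i≢j same = disjoint-map (to ν) (injective ν) {B (to β i)} {B (to β j)}
    (proper (to β i) (to β j) (λ eq → i≢j (injective β eq)) (injective κ same))

module _ {n : ℕ} where

  disjoint? : (c d : Claw (Fin n)) → Dec (Disjoint c d)
  disjoint? c d = all? λ v → isVertex? _≟_ v c →-dec ¬? (isVertex? _≟_ v d)

  ∃!? : ∀ {P : Fin n → Set} → (∀ i → Dec (P i)) → Dec (∃! _≡_ P)
  ∃!? P? = map′ (λ (i , p , unique) → i , p , λ {j} → unique j) (λ (i , p , unique) → i , p , λ j → unique)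
    (any? λ i → P? i ×-dec all? λ j → P? j →-dec (i ≟ j))

-- Addition modulo s

module _ {s : ℕ} .{{_ : NonZero s}} where

  %-view : ∀ {x} → x < s + s → x ≡ x % s ⊎ x ≡ x % s + s
  %-view {x} x<2s with x ℕ.<? s
  ... | yes x<s = inj₁ (sym (m<n⇒m%n≡m x<s))
  ... | no x≮s = inj₂ (begin
    x                 ≡⟨ sym (m∸n+n≡m s≤x) ⟩
    x ∸ s + s         ≡⟨ cong (_+ s) (sym (m<n⇒m%n≡m x∸s<s)) ⟩
    (x ∸ s) % s + s   ≡⟨ cong (_+ s) (m≤n⇒[n∸m]%m≡n%m s≤x) ⟩
    x % s + s         ∎)
    where
    open ≡-Reasoning
    s≤x = ≮⇒≥ x≮s
    x∸s<s : x ∸ s < s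
    x∸s<s = +-cancelʳ-< _ _ s (subst (_< s + s) (sym (m∸n+n≡m s≤x)) x<2s)

  %-cases : ∀ {x y} → x < s + s → y < s + s → x % s ≡ y % s →
            x ≡ y ⊎ x ≡ y + s ⊎ y ≡ x + s
  %-cases {x} {y} x<2s y<2s eq with %-view x<2s | %-view y<2s
  ... | inj₁ x≡ | inj₁ y≡ = inj₁ (trans x≡ (trans eq (sym y≡)))
  ... | inj₂ x≡ | inj₂ y≡ = inj₁ (trans x≡ (trans (cong (_+ s) eq) (sym y≡)))
  ... | inj₂ x≡ | inj₁ y≡ = inj₂ (inj₁ (trans x≡ (cong (_+ s) (trans eq (sym y≡)))))
  ... | inj₁ x≡ | inj₂ y≡ = inj₂ (inj₂ (trans y≡ (cong (_+ s) (trans (sym eq) (sym x≡)))))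

  infixl 6 _⊕_

  _⊕_ : Fin s → Fin s → Fin s
  a ⊕ b = fromℕ< (m%n<n (toℕ a + toℕ b) s)

  toℕ-⊕ : ∀ a b → toℕ (a ⊕ b) ≡ (toℕ a + toℕ b) % s
  toℕ-⊕ a b = toℕ-fromℕ< _

  sum<2s : ∀ (a b : Fin s) → toℕ a + toℕ b < s + s
  sum<2s a b = +-mono-< (toℕ<n a) (toℕ<n b)

  ⊕-comm : ∀ a b → a ⊕ b ≡ b ⊕ a
  ⊕-comm a b = toℕ-injective (begin
    toℕ (a ⊕ b)               ≡⟨ toℕ-⊕ a b ⟩
    (toℕ a + toℕ b) % s       ≡⟨ cong (_% s) (+-comm (toℕ a) (toℕ b)) ⟩
    (toℕ b + toℕ a) % s       ≡⟨ toℕ-⊕ b a ⟨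
    toℕ (b ⊕ a)               ∎)
    where open ≡-Reasoning

  k+u≢k+v+s : ∀ k {u v} → u < s → k + u ≢ k + v + s
  k+u≢k+v+s k {u} {v} u<s eq = m+n≮n v s (+-cancelˡ-< k _ _
    (subst (_< k + s) (trans eq (+-assoc k v s)) (+-monoʳ-< k u<s)))

  ⊕-cancelˡ : ∀ a b c → a ⊕ b ≡ a ⊕ c → b ≡ c
  ⊕-cancelˡ a b c eq with %-cases (sum<2s a b) (sum<2s a c)
                            (trans (sym (toℕ-⊕ a b)) (trans (cong toℕ eq) (toℕ-⊕ a c)))
  ... | inj₁ a+b≡a+c = toℕ-injective (+-cancelˡ-≡ (toℕ a) _ _ a+b≡a+c)
  ... | inj₂ (inj₁ a+b≡a+c+s) = contradiction a+b≡a+c+s (k+u≢k+v+s (toℕ a) (toℕ<n b))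
  ... | inj₂ (inj₂ a+c≡a+b+s) = contradiction a+c≡a+b+s (k+u≢k+v+s (toℕ a) (toℕ<n c))

⊕-identityˡ : ∀ {n} (b : Fin (suc n)) → zero ⊕ b ≡ b
⊕-identityˡ b = toℕ-injective (trans (toℕ-⊕ zero b) (m<n⇒m%n≡m (toℕ<n b)))

⊕-identityʳ : ∀ {n} (a : Fin (suc n)) → a ⊕ zero ≡ a
⊕-identityʳ a = trans (⊕-comm a zero) (⊕-identityˡ a)

double-injective : ∀ {m n} → m + m ≡ n + n → m ≡ n
double-injective {m} {n} eq = *-cancelˡ-≡ m n 2
  (trans (cong (m +_) (+-identityʳ m)) (trans eq (sym (cong (n +_) (+-identityʳ n)))))

even+odd≢even : ∀ t m n → m + m + suc (t + t) ≢ n + n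
even+odd≢even t m n eq =
  even≢odd n (m + t) (trans (cong (n +_) (+-identityʳ n)) (trans (sym eq) (rearrange t m)))
  where
  rearrange : ∀ t m → m + m + suc (t + t) ≡ suc (2 * (m + t))
  rearrange = solve-∀
    where open import Data.Nat.Tactic.RingSolver

⊕-double-injective : ∀ {t} (a b : Fin (suc (t + t))) → a ⊕ a ≡ b ⊕ b → a ≡ b
⊕-double-injective {t} a b eq with %-cases (sum<2s a a) (sum<2s b b)
                                    (trans (sym (toℕ-⊕ a a)) (trans (cong toℕ eq) (toℕ-⊕ b b)))
... | inj₁ 2a≡2b = toℕ-injective (double-injective 2a≡2b)
... | inj₂ (inj₁ 2a≡2b+s) = contradiction (sym 2a≡2b+s) (even+odd≢even t (toℕ b) (toℕ a))
... | inj₂ (inj₂ 2b≡2a+s) = contradiction (sym 2b≡2a+s) (even+odd≢even t (toℕ a) (toℕ b))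

⊕-sharedSummand : ∀ {n} .{{_ : NonZero n}} (a b c d : Fin n) {h} → a ⊕ b ≡ c ⊕ d →
                  h ≡ a ⊎ h ≡ b → h ≡ c ⊎ h ≡ d → (a ≡ c × b ≡ d) ⊎ (a ≡ d × b ≡ c)
⊕-sharedSummand a b c d eq (inj₁ refl) (inj₁ refl) = inj₁ (refl , ⊕-cancelˡ a b d eq)
⊕-sharedSummand a b c d eq (inj₁ refl) (inj₂ refl) = inj₂ (refl , ⊕-cancelˡ a b c (trans eq (⊕-comm c a)))
⊕-sharedSummand a b c d eq (inj₂ refl) (inj₁ refl) = inj₂ (⊕-cancelˡ b a d (trans (⊕-comm b a) eq) , refl)
⊕-sharedSummand a b c d eq (inj₂ refl) (inj₂ refl) =
  inj₁ (⊕-cancelˡ b a c (trans (⊕-comm b a) (trans eq (⊕-comm c b))) , refl)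

-- The K₆,₆ gadget between two groups

allBool? : {P : Bool → Set} → (∀ b → Dec (P b)) → Dec (∀ b → P b)
allBool? P? =
  map′ (λ (pt , pf) → λ { true → pt ; false → pf }) (λ ∀P → ∀P true , ∀P false) (P? true ×-dec P? false)

shift : Fin 6 → Fin 6
shift = lookup (# 1 ∷ # 2 ∷ # 3 ∷ # 4 ∷ # 5 ∷ # 0 ∷ [])

-- A hub u has tips u, u+1, u+2 on the forward side and u+1, u+2, u+3 on the backward side
-- (mod 6), so an edge uw is covered by exactly one side, according as w − u ∈ {0,1,2} or
-- u − w ∈ {1,2,3}. Hubs of equal colour are u and u + 3, whose tip sets are disjoint.
pairTip₁ pairTip₂ pairTip₃ : Bool → Fin 6 → Fin 6
pairTip₁ true u = u
pairTip₁ false u = shift u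
pairTip₂ b u = shift (pairTip₁ b u)
pairTip₃ b u = shift (pairTip₂ b u)

PairTip : Bool → Fin 6 → Fin 6 → Set
PairTip b u w = w ≡ pairTip₁ b u ⊎ w ≡ pairTip₂ b u ⊎ w ≡ pairTip₃ b u

pairTip? : ∀ b u w → Dec (PairTip b u w)
pairTip? b u w = (w ≟ pairTip₁ b u) ⊎-dec (w ≟ pairTip₂ b u) ⊎-dec (w ≟ pairTip₃ b u)

pairColour : Bool → Fin 6 → Fin 6
pairColour true = lookup (# 0 ∷ # 1 ∷ # 2 ∷ # 0 ∷ # 1 ∷ # 2 ∷ [])
pairColour false = lookup (# 3 ∷ # 4 ∷ # 5 ∷ # 3 ∷ # 4 ∷ # 5 ∷ [])

pairTips-distinct : ∀ b u →
  pairTip₁ b u ≢ pairTip₂ b u × pairTip₁ b u ≢ pairTip₃ b u × pairTip₂ b u ≢ pairTip₃ b u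
pairTips-distinct = from-yes (allBool? λ b → all? λ u →
  ¬? (pairTip₁ b u ≟ pairTip₂ b u) ×-dec ¬? (pairTip₁ b u ≟ pairTip₃ b u) ×-dec ¬? (pairTip₂ b u ≟ pairTip₃ b u))

pairTip-orientation : ∀ b u w → PairTip b u w ⊎ PairTip (not b) w u
pairTip-orientation = from-yes (allBool? λ b → all? λ u → all? λ w → pairTip? b u w ⊎-dec pairTip? (not b) w u)

pairTip-exclusive : ∀ b u w → PairTip b u w → ¬ PairTip (not b) w u
pairTip-exclusive = from-yes (allBool? λ b → all? λ u → all? λ w →
  pairTip? b u w →-dec ¬? (pairTip? (not b) w u))

pairColour-proper : ∀ b u u′ → u ≢ u′ → pairColour b u ≡ pairColour b u′ →
                    ∀ w → PairTip b u w → ¬ PairTip b u′ w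
pairColour-proper = from-yes (allBool? λ b → all? λ u → all? λ u′ → ¬? (u ≟ u′) →-dec
  (pairColour b u ≟ pairColour b u′) →-dec all? λ w → pairTip? b u w →-dec ¬? (pairTip? b u′ w))

pairColour-orientation : ∀ b u u′ → pairColour b u ≢ pairColour (not b) u′
pairColour-orientation = from-yes (allBool? λ b → all? λ u → all? λ u′ →
  ¬? (pairColour b u ≟ pairColour (not b) u′))

pairColour-onto : ∀ x → (∃ λ u → pairColour true u ≡ x) ⊎ (∃ λ u → pairColour false u ≡ x)
pairColour-onto = from-yes (all? λ x →
  any? (λ u → pairColour true u ≟ x) ⊎-dec any? (λ u → pairColour false u ≟ x))

-- The K₁₀ gadgets

-- Vertices 0–5 of a gadget are the six vertices of one group, 6–9 the four fixed points.
Local : Set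
Local = Fin 10

LocalColour : Set
LocalColour = Fin 3 ⊎ Fin 6

Fixed : Local → Set
Fixed x = 6 ≤ toℕ x

mkClaw : (h a b c : Local) →
  {True (¬? (h ≟ a) ×-dec ¬? (h ≟ b) ×-dec ¬? (h ≟ c) ×-dec ¬? (a ≟ b) ×-dec ¬? (a ≟ c) ×-dec ¬? (b ≟ c))} →
  Claw Local
mkClaw h a b c {distinct} =
  let h≢a , h≢b , h≢c , a≢b , a≢c , b≢c = toWitness distinct
  in claw h a b c h≢a h≢b h≢c a≢b a≢c b≢c

baseClaw : Fin 15 → Claw Local
baseClaw = lookup
  ( mkClaw (# 8) (# 1) (# 2) (# 9) ∷ mkClaw (# 8) (# 3) (# 5) (# 7) ∷ mkClaw (# 6) (# 0) (# 8) (# 9)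
  ∷ mkClaw (# 0) (# 3) (# 7) (# 8) ∷ mkClaw (# 9) (# 0) (# 3) (# 7) ∷ mkClaw (# 3) (# 2) (# 4) (# 7)
  ∷ mkClaw (# 6) (# 2) (# 3) (# 5) ∷ mkClaw (# 7) (# 1) (# 2) (# 6) ∷ mkClaw (# 2) (# 0) (# 4) (# 9)
  ∷ mkClaw (# 4) (# 6) (# 7) (# 9) ∷ mkClaw (# 4) (# 0) (# 5) (# 8) ∷ mkClaw (# 5) (# 0) (# 1) (# 3)
  ∷ mkClaw (# 5) (# 2) (# 7) (# 9) ∷ mkClaw (# 1) (# 2) (# 4) (# 9) ∷ mkClaw (# 1) (# 0) (# 3) (# 6)
  ∷ [])

baseColour : Fin 15 → LocalColour
baseColour = lookup
  ( inj₂ (# 0) ∷ inj₂ (# 1) ∷ inj₂ (# 2) ∷ inj₂ (# 3) ∷ inj₂ (# 4) ∷ inj₂ (# 2) ∷ inj₂ (# 5) ∷ inj₁ (# 0)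
  ∷ inj₂ (# 1) ∷ inj₁ (# 1) ∷ inj₁ (# 0) ∷ inj₁ (# 1) ∷ inj₁ (# 2) ∷ inj₂ (# 3) ∷ inj₁ (# 2) ∷ [])

groupClaw : Fin 13 → Claw Local
groupClaw = lookup
  ( mkClaw (# 0) (# 1) (# 2) (# 3) ∷ mkClaw (# 6) (# 0) (# 4) (# 5) ∷ mkClaw (# 7) (# 0) (# 2) (# 3)
  ∷ mkClaw (# 0) (# 4) (# 8) (# 9) ∷ mkClaw (# 2) (# 6) (# 8) (# 9) ∷ mkClaw (# 3) (# 6) (# 8) (# 9)
  ∷ mkClaw (# 2) (# 1) (# 3) (# 5) ∷ mkClaw (# 5) (# 0) (# 3) (# 7) ∷ mkClaw (# 5) (# 4) (# 8) (# 9)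
  ∷ mkClaw (# 4) (# 3) (# 8) (# 9) ∷ mkClaw (# 4) (# 1) (# 2) (# 7) ∷ mkClaw (# 1) (# 5) (# 6) (# 7)
  ∷ mkClaw (# 1) (# 3) (# 8) (# 9) ∷ [])

groupColour : Fin 13 → LocalColour
groupColour = lookup
  ( inj₁ (# 0) ∷ inj₂ (# 0) ∷ inj₂ (# 1) ∷ inj₂ (# 2) ∷ inj₂ (# 3) ∷ inj₂ (# 4) ∷ inj₂ (# 2)
  ∷ inj₂ (# 3) ∷ inj₂ (# 1) ∷ inj₂ (# 5) ∷ inj₂ (# 4) ∷ inj₂ (# 5) ∷ inj₂ (# 0) ∷ [])

_≟ᶜ_ : (c d : LocalColour) → Dec (c ≡ d)
_≟ᶜ_ = ≡-dec _≟_ _≟_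

fixed? : ∀ x → Dec (Fixed x)
fixed? x = 6 ℕ.≤? toℕ x

bothFixed? : ∀ x y → Dec (Fixed x × Fixed y)
bothFixed? x y = fixed? x ×-dec fixed? y

baseClaw-system : IsClawSystem baseClaw
baseClaw-system = from-yes (all? λ x → all? λ y → ¬? (x ≟ y) →-dec ∃!? λ i → isEdge? _≟_ x y (baseClaw i))

baseColour-colouring : IsClawColouring baseClaw baseColour
baseColour-colouring = onto , proper
  where
  onto : StrictlySurjective _≡_ baseColour
  onto (inj₁ e) = from-yes (all? λ e → any? λ i → baseColour i ≟ᶜ inj₁ e) e
  onto (inj₂ x) = from-yes (all? λ x → any? λ i → baseColour i ≟ᶜ inj₂ x) x
  proper : ∀ i j → i ≢ j → baseColour i ≡ baseColour j → Disjoint (baseClaw i) (baseClaw j)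
  proper = from-yes (all? λ i → all? λ j → ¬? (i ≟ j) →-dec (baseColour i ≟ᶜ baseColour j) →-dec
    disjoint? (baseClaw i) (baseClaw j))

groupClaw-covers : ∀ x y → x ≢ y → ¬ (Fixed x × Fixed y) → ∃! _≡_ λ i → IsEdge x y (groupClaw i)
groupClaw-covers = from-yes (all? λ x → all? λ y → ¬? (x ≟ y) →-dec ¬? (bothFixed? x y) →-dec
  ∃!? λ i → isEdge? _≟_ x y (groupClaw i))

groupClaw-unfixedEdge : ∀ i x y → IsEdge x y (groupClaw i) → ¬ (Fixed x × Fixed y)
groupClaw-unfixedEdge = from-yes (all? λ i → all? λ x → all? λ y →
  isEdge? _≟_ x y (groupClaw i) →-dec ¬? (bothFixed? x y))

groupColour-proper : ∀ i j → i ≢ j → groupColour i ≡ groupColour j → Disjoint (groupClaw i) (groupClaw j)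
groupColour-proper = from-yes (all? λ i → all? λ j → ¬? (i ≟ j) →-dec (groupColour i ≟ᶜ groupColour j) →-dec
  disjoint? (groupClaw i) (groupClaw j))

Unfixed : Claw Local → Set
Unfixed c = ∀ v → IsVertex v c → ¬ Fixed v

groupColour-special-unfixed : ∀ i e → groupColour i ≡ inj₁ e → Unfixed (groupClaw i)
groupColour-special-unfixed = from-yes (all? λ i → all? λ e → (groupColour i ≟ᶜ inj₁ e) →-dec
  all? λ v → isVertex? _≟_ v (groupClaw i) →-dec ¬? (fixed? v))

-- The construction for n = 12t + 10

module Construction (t : ℕ) where

  r : ℕ
  r = t + t

  Group : Set
  Group = Fin (suc r)

  Vertex : Set
  Vertex = Fin 4 ⊎ (Group × Fin 6)

  Colour : Set
  Colour = Fin 3 ⊎ (Group × Fin 6)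

  place : Group → Fin 6 ⊎ Fin 4 → Vertex
  place g (inj₁ u) = inj₂ (g , u)
  place g (inj₂ d) = inj₁ d

  embed : Group → Local → Vertex
  embed g = place g ∘ splitAt 6

  place-injective : ∀ {g h p q} → place g p ≡ place h q → p ≡ q
  place-injective {p = inj₁ _} {inj₁ _} refl = refl
  place-injective {p = inj₂ _} {inj₂ _} refl = refl

  embed-injective₂ : ∀ {g h} x y → embed g x ≡ embed h y → x ≡ y
  embed-injective₂ x y eq = begin
    x                       ≡⟨ join-splitAt 6 4 x ⟨
    join 6 4 (splitAt 6 x)  ≡⟨ cong (join 6 4) (place-injective eq) ⟩
    join 6 4 (splitAt 6 y)  ≡⟨ join-splitAt 6 4 y ⟩
    y                       ∎
    where open ≡-Reasoning

  embed-injective : ∀ g → Injective _≡_ _≡_ (embed g)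
  embed-injective g = embed-injective₂ _ _

  embed-group : ∀ {g a u} x → embed g x ≡ inj₂ (a , u) → a ≡ g
  embed-group x eq with splitAt 6 x
  ... | inj₁ _ = sym (,-injectiveˡ (inj₂-injective eq))
  ... | inj₂ _ with () ← eq

  embed-unfixed : ∀ {g h} x → ¬ Fixed x → embed g x ≡ embed h x → g ≡ h
  embed-unfixed x x<6 eq rewrite splitAt-< 6 x (≰⇒> x<6) =
    ,-injectiveˡ (inj₂-injective eq)

  fixedVertex : ∀ g d → embed g (6 ↑ʳ d) ≡ inj₁ d
  fixedVertex g d = cong (place g) (splitAt-↑ʳ 6 4 d)

  groupVertex : ∀ g u → embed g (u ↑ˡ 4) ≡ inj₂ (g , u)
  groupVertex g u = cong (place g) (splitAt-↑ˡ 6 u 4)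

  groupVertex-unfixed : ∀ (u : Fin 6) → ¬ Fixed (u ↑ˡ 4)
  groupVertex-unfixed u = <⇒≱ (subst (_< 6) (sym (toℕ-↑ˡ u 4)) (toℕ<n u))

  GadgetIndex : Group → Set
  GadgetIndex zero = Fin 15
  GadgetIndex (suc _) = Fin 13

  gadgetClaw : ∀ h → GadgetIndex h → Claw Local
  gadgetClaw zero = baseClaw
  gadgetClaw (suc _) = groupClaw

  gadgetColour : ∀ h → GadgetIndex h → LocalColour
  gadgetColour zero = baseColour
  gadgetColour (suc _) = groupColour

  gadget-covers : ∀ h x y → x ≢ y → h ≡ zero ⊎ ¬ (Fixed x × Fixed y) →
                  ∃! _≡_ λ i → IsEdge x y (gadgetClaw h i)
  gadget-covers zero x y x≢y _ = baseClaw-system x y x≢y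
  gadget-covers (suc _) x y x≢y (inj₂ unfixed) = groupClaw-covers x y x≢y unfixed

  gadget-fixedEdge : ∀ h i {x y} → IsEdge x y (gadgetClaw h i) → Fixed x × Fixed y → h ≡ zero
  gadget-fixedEdge zero i e fixed = refl
  gadget-fixedEdge (suc _) i e fixed = contradiction fixed (groupClaw-unfixedEdge i _ _ e)

  gadget-proper : ∀ h i j → i ≢ j → gadgetColour h i ≡ gadgetColour h j →
                  Disjoint (gadgetClaw h i) (gadgetClaw h j)
  gadget-proper zero = proj₂ baseColour-colouring
  gadget-proper (suc _) = groupColour-proper

  LocalBlock : Set
  LocalBlock = Σ Group GadgetIndex

  localClaw : LocalBlock → Claw Vertex
  localClaw (h , i) = mapClaw (embed h) (embed-injective h) (gadgetClaw h i)

  localClaw-vertex : ∀ h i {v} → IsVertex v (localClaw (h , i)) → ∃ λ x → v ≡ embed h x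
  localClaw-vertex h i = vertex-map-image (embed h) (embed-injective h) (gadgetClaw h i)

  localClaw-edge⁻ : ∀ h i g x y → IsEdge (embed g x) (embed g y) (localClaw (h , i)) →
                    IsEdge x y (gadgetClaw h i) × embed g x ≡ embed h x × embed g y ≡ embed h y
  localClaw-edge⁻ h i g x y e
    with localClaw-vertex h i (proj₁ (edge-vertices (localClaw (h , i)) e))
       | localClaw-vertex h i (proj₂ (edge-vertices (localClaw (h , i)) e))
  ... | x′ , gx≡hx′ | y′ , gy≡hy′ with embed-injective₂ x x′ gx≡hx′ | embed-injective₂ y y′ gy≡hy′
  ... | refl | refl = isEdge-map⁻ (embed h) (embed-injective h) (gadgetClaw h i)
                        (subst₂ (λ a b → IsEdge a b (localClaw (h , i))) gx≡hx′ gy≡hy′ e) ,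
                      gx≡hx′ , gy≡hy′

  localClaw-home : ∀ h i g x y → IsEdge (embed g x) (embed g y) (localClaw (h , i)) →
                   g ≡ zero ⊎ ¬ (Fixed x × Fixed y) → h ≡ g
  localClaw-home h i g x y e g-ok with localClaw-edge⁻ h i g x y e
  ... | e′ , gx≡hx , gy≡hy with fixed? x | fixed? y
  ... | no x-unfixed | _ = sym (embed-unfixed x x-unfixed gx≡hx)
  ... | yes _ | no y-unfixed = sym (embed-unfixed y y-unfixed gy≡hy)
  ... | yes x-fixed | yes y-fixed with g-ok
  ...   | inj₁ refl = gadget-fixedEdge h i e′ (x-fixed , y-fixed)
  ...   | inj₂ not-both = contradiction (x-fixed , y-fixed) not-both

  localClaw-withinGroup : ∀ h i {a b u w} → a ≢ b → ¬ IsEdge (inj₂ (a , u)) (inj₂ (b , w)) (localClaw (h , i))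
  localClaw-withinGroup h i a≢b e
    with localClaw-vertex h i (proj₁ (edge-vertices (localClaw (h , i)) e))
       | localClaw-vertex h i (proj₂ (edge-vertices (localClaw (h , i)) e))
  ... | x , au≡hx | y , bw≡hy = a≢b (trans (embed-group x (sym au≡hx)) (sym (embed-group y (sym bw≡hy))))

  forward : Group → Group → Bool
  forward a b = does (a <? b)

  forward-flip : ∀ {a b} → a ≢ b → forward b a ≡ not (forward a b)
  forward-flip {a} {b} a≢b with <-cmp a b
  ... | tri< a<b _ b≮a = trans (dec-false (b <? a) b≮a) (cong not (sym (dec-true (a <? b) a<b)))
  ... | tri≈ _ a≡b _ = contradiction a≡b a≢b
  ... | tri> a≮b _ b<a = trans (dec-true (b <? a) b<a) (cong not (sym (dec-false (a <? b) a≮b)))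

  pairClaw : (a b : Group) → a ≢ b → Fin 6 → Claw Vertex
  pairClaw a b a≢b u = claw (inj₂ (a , u))
    (inj₂ (b , pairTip₁ o u)) (inj₂ (b , pairTip₂ o u)) (inj₂ (b , pairTip₃ o u))
    different-groups different-groups different-groups
    (different-tips (proj₁ distinct)) (different-tips (proj₁ (proj₂ distinct)))
    (different-tips (proj₂ (proj₂ distinct)))
    where
    o = forward a b
    distinct = pairTips-distinct o u
    different-groups : ∀ {w} → inj₂ (a , u) ≢ inj₂ (b , w)
    different-groups = a≢b ∘ ,-injectiveˡ ∘ inj₂-injective
    different-tips : ∀ {w w′} → w ≢ w′ → inj₂ (b , w) ≢ inj₂ (b , w′)
    different-tips w≢w′ = w≢w′ ∘ ,-injectiveʳ ∘ inj₂-injective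

  pairClaw-tip⁺ : ∀ a b p u {w} → PairTip (forward a b) u w → IsTip (inj₂ (b , w)) (pairClaw a b p u)
  pairClaw-tip⁺ a b p u (inj₁ refl) = inj₁ refl
  pairClaw-tip⁺ a b p u (inj₂ (inj₁ refl)) = inj₂ (inj₁ refl)
  pairClaw-tip⁺ a b p u (inj₂ (inj₂ refl)) = inj₂ (inj₂ refl)

  pairClaw-tip⁻ : ∀ a b p u {y} → IsTip y (pairClaw a b p u) →
                  ∃ λ w → y ≡ inj₂ (b , w) × PairTip (forward a b) u w
  pairClaw-tip⁻ a b p u (inj₁ refl) = _ , refl , inj₁ refl
  pairClaw-tip⁻ a b p u (inj₂ (inj₁ refl)) = _ , refl , inj₂ (inj₁ refl)
  pairClaw-tip⁻ a b p u (inj₂ (inj₂ refl)) = _ , refl , inj₂ (inj₂ refl)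

  pairClaw-vertex : ∀ a b p u {v} → IsVertex v (pairClaw a b p u) →
                    v ≡ inj₂ (a , u) ⊎ ∃ λ w → v ≡ inj₂ (b , w) × PairTip (forward a b) u w
  pairClaw-vertex a b p u (inj₁ v≡hub) = inj₁ v≡hub
  pairClaw-vertex a b p u (inj₂ v∈tips) = inj₂ (pairClaw-tip⁻ a b p u v∈tips)

  pairClaw-notLocal : ∀ a b p u g x y → ¬ IsEdge (embed g x) (embed g y) (pairClaw a b p u)
  pairClaw-notLocal a b p u g x y (inj₁ (gx≡hub , gy∈tips)) with pairClaw-tip⁻ a b p u gy∈tips
  ... | _ , gy≡ , _ = p (trans (embed-group x gx≡hub) (sym (embed-group y gy≡)))
  pairClaw-notLocal a b p u g x y (inj₂ (gy≡hub , gx∈tips)) with pairClaw-tip⁻ a b p u gx∈tips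
  ... | _ , gx≡ , _ = p (trans (embed-group y gy≡hub) (sym (embed-group x gx≡)))

  PairBlock : Set
  PairBlock = Group × Fin r × Fin 6

  Block : Set
  Block = PairBlock ⊎ LocalBlock

  hub≢partner : ∀ (a : Group) e → a ≢ punchIn a e
  hub≢partner a e = punchInᵢ≢i a e ∘ sym

  blockClaw : Block → Claw Vertex
  blockClaw (inj₁ (a , e , u)) = pairClaw a (punchIn a e) (hub≢partner a e) u
  blockClaw (inj₂ l) = localClaw l

  liftColour : Group → LocalColour → Colour
  liftColour h (inj₁ e) = inj₁ e
  liftColour h (inj₂ x) = inj₂ (h ⊕ h , x)

  blockColour : Block → Colour
  blockColour (inj₁ (a , e , u)) = inj₂ (a ⊕ punchIn a e , pairColour (forward a (punchIn a e)) u)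
  blockColour (inj₂ (h , i)) = liftColour h (gadgetColour h i)

  pairBlock : ∀ {a b} → a ≢ b → Fin 6 → Block
  pairBlock {a} a≢b u = inj₁ (a , punchOut a≢b , u)

  pairBlock-edge : ∀ {a b u w} (a≢b : a ≢ b) → PairTip (forward a b) u w →
                   IsEdge (inj₂ (a , u)) (inj₂ (b , w)) (blockClaw (pairBlock a≢b u))
  pairBlock-edge {a} {u = u} {w} a≢b =
    subst (λ b → PairTip (forward a b) u w → IsEdge (inj₂ (a , u)) (inj₂ (b , w)) (blockClaw (pairBlock a≢b u)))
      (punchIn-punchOut a≢b) (λ tip → inj₁ (refl , pairClaw-tip⁺ a _ (hub≢partner a (punchOut a≢b)) u tip))

  pairBlock-unique : ∀ {a b} (a≢b : a ≢ b) e u → punchIn a e ≡ b → pairBlock a≢b u ≡ inj₁ (a , e , u)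
  pairBlock-unique {a} a≢b e u partner = cong (λ e → inj₁ (a , e , u))
    (punchIn-injective a (punchOut a≢b) e (trans (punchIn-punchOut a≢b) (sym partner)))

  pairBlock-edge⁻ : ∀ {a b u w} a′ e′ u′ →
    IsEdge (inj₂ (a , u)) (inj₂ (b , w)) (blockClaw (inj₁ (a′ , e′ , u′))) →
    (a′ ≡ a × u′ ≡ u × punchIn a′ e′ ≡ b × PairTip (forward a b) u w) ⊎
    (a′ ≡ b × u′ ≡ w × punchIn a′ e′ ≡ a × PairTip (forward b a) w u)
  pairBlock-edge⁻ a′ e′ u′ (inj₁ (refl , tip)) with pairClaw-tip⁻ a′ _ (hub≢partner a′ e′) u′ tip
  ... | _ , refl , pairTip = inj₁ (refl , refl , refl , pairTip)
  pairBlock-edge⁻ a′ e′ u′ (inj₂ (refl , tip)) with pairClaw-tip⁻ a′ _ (hub≢partner a′ e′) u′ tip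
  ... | _ , refl , pairTip = inj₂ (refl , refl , refl , pairTip)

  forwardCover : ∀ {a b u w} (a≢b : a ≢ b) → PairTip (forward a b) u w →
                 ∃! _≡_ λ k → IsEdge (inj₂ (a , u)) (inj₂ (b , w)) (blockClaw k)
  forwardCover {a} {b} {u} {w} a≢b tip = pairBlock a≢b u , pairBlock-edge a≢b tip , unique
    where
    unique : ∀ {k} → IsEdge (inj₂ (a , u)) (inj₂ (b , w)) (blockClaw k) → pairBlock a≢b u ≡ k
    unique {inj₂ (h , i)} e = contradiction e (localClaw-withinGroup h i a≢b)
    unique {inj₁ (a′ , e′ , u′)} e with pairBlock-edge⁻ a′ e′ u′ e
    ... | inj₁ (refl , refl , partner , _) = pairBlock-unique a≢b e′ u partner
    ... | inj₂ (refl , refl , _ , tip′) = contradiction (subst (λ o → PairTip o w u) (forward-flip a≢b) tip′)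
                                                        (pairTip-exclusive (forward a b) u w tip)

  pairCover : ∀ {a b} u w → a ≢ b → ∃! _≡_ λ k → IsEdge (inj₂ (a , u)) (inj₂ (b , w)) (blockClaw k)
  pairCover {a} {b} u w a≢b with pairTip-orientation (forward a b) u w
  ... | inj₁ tip = forwardCover a≢b tip
  ... | inj₂ tip = uniqueEdge-sym blockClaw
    (forwardCover (a≢b ∘ sym) (subst (λ o → PairTip o w u) (sym (forward-flip a≢b)) tip))

  localCover : ∀ h x y → x ≢ y → h ≡ zero ⊎ ¬ (Fixed x × Fixed y) →
               ∃! _≡_ λ k → IsEdge (embed h x) (embed h y) (blockClaw k)
  localCover h x y x≢y h-ok with gadget-covers h x y x≢y h-ok
  ... | i , e , unique = inj₂ (h , i) , isEdge-map⁺ (embed h) (embed-injective h) (gadgetClaw h i) e , unique′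
    where
    unique′ : ∀ {k} → IsEdge (embed h x) (embed h y) (blockClaw k) → inj₂ (h , i) ≡ k
    unique′ {inj₁ (a , f , u)} e′ = contradiction e′ (pairClaw-notLocal a _ (hub≢partner a f) u h x y)
    unique′ {inj₂ (h′ , i′)} e′ with localClaw-home h′ i′ h x y e′ h-ok
    ... | refl = cong (λ i → inj₂ (h , i)) (unique (proj₁ (localClaw-edge⁻ h i′ h x y e′)))

  localCover′ : ∀ h {x y} x′ y′ → embed h x′ ≡ x → embed h y′ ≡ y → x ≢ y →
                h ≡ zero ⊎ ¬ (Fixed x′ × Fixed y′) → ∃! _≡_ λ k → IsEdge x y (blockClaw k)
  localCover′ h x′ y′ refl refl x≢y = localCover h x′ y′ (x≢y ∘ cong (embed h))

  blockClaw-system : IsClawSystem blockClaw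
  blockClaw-system (inj₁ d) (inj₁ d′) x≢y =
    localCover′ zero (6 ↑ʳ d) (6 ↑ʳ d′) (fixedVertex zero d) (fixedVertex zero d′) x≢y (inj₁ refl)
  blockClaw-system (inj₁ d) (inj₂ (g , u)) x≢y =
    localCover′ g (6 ↑ʳ d) (u ↑ˡ 4) (fixedVertex g d) (groupVertex g u) x≢y (inj₂ (groupVertex-unfixed u ∘ proj₂))
  blockClaw-system (inj₂ (g , u)) (inj₁ d) x≢y =
    localCover′ g (u ↑ˡ 4) (6 ↑ʳ d) (groupVertex g u) (fixedVertex g d) x≢y (inj₂ (groupVertex-unfixed u ∘ proj₁))
  blockClaw-system (inj₂ (a , u)) (inj₂ (b , w)) x≢y with a ≟ b
  ... | yes refl = localCover′ a (u ↑ˡ 4) (w ↑ˡ 4) (groupVertex a u) (groupVertex a w) x≢y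
                     (inj₂ (groupVertex-unfixed u ∘ proj₁))
  ... | no a≢b = pairCover u w a≢b

  liftColour-injective : ∀ h {c d} → liftColour h c ≡ liftColour h d → c ≡ d
  liftColour-injective h {inj₁ _} {inj₁ _} refl = refl
  liftColour-injective h {inj₂ _} {inj₂ _} eq = cong inj₂ (,-injectiveʳ (inj₂-injective eq))

  liftColour-ordinary : ∀ h c {f x} → liftColour h c ≡ inj₂ (f , x) → h ⊕ h ≡ f
  liftColour-ordinary h (inj₂ _) refl = refl

  liftColour-special : ∀ {h h′} c c′ → h ≢ h′ → liftColour h c ≡ liftColour h′ c′ →
                       ∃ λ e → c ≡ inj₁ e × c′ ≡ inj₁ e
  liftColour-special (inj₁ e) (inj₁ .e) _ refl = e , refl , refl
  liftColour-special (inj₁ _) (inj₂ _) _ ()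
  liftColour-special (inj₂ _) (inj₁ _) _ ()
  liftColour-special {h} {h′} (inj₂ _) (inj₂ _) h≢h′ eq =
    contradiction (⊕-double-injective {t} h h′ (,-injectiveˡ (inj₂-injective eq))) h≢h′

  localClaws-disjoint : ∀ {h h′} i i′ → h ≢ h′ → Unfixed (gadgetClaw h i) →
                        Disjoint (localClaw (h , i)) (localClaw (h′ , i′))
  localClaws-disjoint {h} {h′} i i′ h≢h′ unfixed v v∈ v∈′
    with localClaw-vertex h i v∈ | localClaw-vertex h′ i′ v∈′
  ... | x , refl | x′ , hx≡h′x′ with embed-injective₂ x x′ hx≡h′x′
  ... | refl = h≢h′ (embed-unfixed x x-unfixed hx≡h′x′)
    where
    x-unfixed = unfixed x (isVertex-map⁻ (embed h) (embed-injective h) (gadgetClaw h i) v∈)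

  specialClaws-disjoint : ∀ h i h′ i′ {e} → h ≢ h′ → gadgetColour h i ≡ inj₁ e → gadgetColour h′ i′ ≡ inj₁ e →
                          Disjoint (localClaw (h , i)) (localClaw (h′ , i′))
  specialClaws-disjoint (suc _) i h′ i′ h≢h′ special _ =
    localClaws-disjoint i i′ h≢h′ (groupColour-special-unfixed i _ special)
  specialClaws-disjoint zero i (suc _) i′ h≢h′ _ special′ =
    disjoint-sym {c = localClaw (_ , i′)} {localClaw (zero , i)}
      (localClaws-disjoint i′ i (h≢h′ ∘ sym) (groupColour-special-unfixed i′ _ special′))
  specialClaws-disjoint zero i zero i′ h≢h′ _ _ = contradiction refl h≢h′

  localBlocks-proper : ∀ h i h′ i′ → (h , i) ≢ (h′ , i′) →
                       liftColour h (gadgetColour h i) ≡ liftColour h′ (gadgetColour h′ i′) →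
                       Disjoint (localClaw (h , i)) (localClaw (h′ , i′))
  localBlocks-proper h i h′ i′ ne same with h ≟ h′
  ... | yes refl = disjoint-map (embed h) (embed-injective h) {gadgetClaw h i} {gadgetClaw h i′}
                     (gadget-proper h i i′ (ne ∘ cong (h ,_)) (liftColour-injective h same))
  ... | no h≢h′ with liftColour-special (gadgetColour h i) (gadgetColour h′ i′) h≢h′ same
  ...   | _ , special , special′ = specialClaws-disjoint h i h′ i′ h≢h′ special special′

  pairClaws-disjoint : ∀ a b p p′ u u′ → u ≢ u′ → pairColour (forward a b) u ≡ pairColour (forward a b) u′ →
                       Disjoint (pairClaw a b p u) (pairClaw a b p′ u′)
  pairClaws-disjoint a b p p′ u u′ u≢u′ same v v∈ v∈′
    with pairClaw-vertex a b p u v∈ | pairClaw-vertex a b p′ u′ v∈′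
  ... | inj₁ refl | inj₁ v≡ = u≢u′ (,-injectiveʳ (inj₂-injective v≡))
  ... | inj₁ refl | inj₂ (_ , v≡ , _) = p (,-injectiveˡ (inj₂-injective v≡))
  ... | inj₂ (_ , refl , _) | inj₁ v≡ = p (sym (,-injectiveˡ (inj₂-injective v≡)))
  ... | inj₂ (w , refl , tip) | inj₂ (_ , v≡ , tip′) =
    pairColour-proper (forward a b) u u′ u≢u′ same w tip
      (subst (PairTip (forward a b) u′) (sym (,-injectiveʳ (inj₂-injective v≡))) tip′)

  pairClaw-group : ∀ a b p u {v} → IsVertex v (pairClaw a b p u) →
                   ∃ λ h → ∃ λ w → v ≡ inj₂ (h , w) × (h ≡ a ⊎ h ≡ b)
  pairClaw-group a b p u v∈ with pairClaw-vertex a b p u v∈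
  ... | inj₁ v≡ = a , u , v≡ , inj₁ refl
  ... | inj₂ (w , v≡ , _) = b , w , v≡ , inj₂ refl

  pairBlocks-proper : ∀ a e u a′ e′ u′ → (a , e , u) ≢ (a′ , e′ , u′) →
                      blockColour (inj₁ (a , e , u)) ≡ blockColour (inj₁ (a′ , e′ , u′)) →
                      Disjoint (blockClaw (inj₁ (a , e , u))) (blockClaw (inj₁ (a′ , e′ , u′)))
  pairBlocks-proper a e u a′ e′ u′ ne same v v∈ v∈′
    with pairClaw-group a _ (hub≢partner a e) u v∈ | pairClaw-group a′ _ (hub≢partner a′ e′) u′ v∈′
  ... | _ , _ , refl , h∈ | _ , _ , v≡ , h′∈
    with ⊕-sharedSummand a (punchIn a e) a′ (punchIn a′ e′) (,-injectiveˡ (inj₂-injective same)) h∈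
           (subst (λ h → h ≡ a′ ⊎ h ≡ punchIn a′ e′) (sym (,-injectiveˡ (inj₂-injective v≡))) h′∈)
  ... | inj₂ (a≡b′ , b≡a′) = pairColour-orientation (forward a (punchIn a e)) u u′
          (trans (,-injectiveʳ (inj₂-injective same)) (cong (λ o → pairColour o u′) swapped))
    where
    swapped : forward a′ (punchIn a′ e′) ≡ not (forward a (punchIn a e))
    swapped = trans (cong₂ forward (sym b≡a′) (sym a≡b′)) (forward-flip (hub≢partner a e))
  ... | inj₁ (refl , b≡b′) with punchIn-injective a e e′ b≡b′
  ... | refl = pairClaws-disjoint a _ (hub≢partner a e) (hub≢partner a e) u u′
                 (ne ∘ cong (λ u → a , e , u)) (,-injectiveʳ (inj₂-injective same)) v v∈ v∈′

  pairLocal-disjoint : ∀ a b p u h i → h ⊕ h ≡ a ⊕ b → Disjoint (pairClaw a b p u) (localClaw (h , i))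
  pairLocal-disjoint a b p u h i hh≡ab v v∈pair v∈local with localClaw-vertex h i v∈local
  ... | x , refl with pairClaw-vertex a b p u v∈pair
  ...   | inj₁ hx≡au = p (⊕-cancelˡ a a b (trans (cong (λ g → g ⊕ g) (embed-group x hx≡au)) hh≡ab))
  ...   | inj₂ (_ , hx≡bw , _) =
    p (sym (⊕-cancelˡ b b a (trans (cong (λ g → g ⊕ g) (embed-group x hx≡bw)) (trans hh≡ab (⊕-comm a b)))))

  blockColour-proper : ∀ k k′ → k ≢ k′ → blockColour k ≡ blockColour k′ →
                       Disjoint (blockClaw k) (blockClaw k′)
  blockColour-proper (inj₁ (a , e , u)) (inj₁ (a′ , e′ , u′)) k≢k′ =
    pairBlocks-proper a e u a′ e′ u′ (k≢k′ ∘ cong inj₁)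
  blockColour-proper (inj₁ (a , e , u)) (inj₂ (h , i)) _ same =
    pairLocal-disjoint a _ (hub≢partner a e) u h i (liftColour-ordinary h (gadgetColour h i) (sym same))
  blockColour-proper (inj₂ (h , i)) (inj₁ (a , e , u)) _ same =
    disjoint-sym {c = blockClaw (inj₁ (a , e , u))} {localClaw (h , i)}
      (pairLocal-disjoint a _ (hub≢partner a e) u h i (liftColour-ordinary h (gadgetColour h i) same))
  blockColour-proper (inj₂ (h , i)) (inj₂ (h′ , i′)) k≢k′ =
    localBlocks-proper h i h′ i′ (k≢k′ ∘ cong inj₂)

  -- Class (f, x) with f ≠ 0 is reached by a claw between groups 0 and f.
  blockColour-onto : StrictlySurjective _≡_ blockColour
  blockColour-onto (inj₁ e) with proj₁ baseColour-colouring (inj₁ e)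
  ... | i , eq = inj₂ (zero , i) , cong (liftColour zero) eq
  blockColour-onto (inj₂ (zero , x)) with proj₁ baseColour-colouring (inj₂ x)
  ... | i , eq = inj₂ (zero , i) ,
    trans (cong (liftColour zero) eq) (cong (λ f → inj₂ (f , x)) (⊕-identityˡ zero))
  blockColour-onto (inj₂ (suc g , x)) with pairColour-onto x
  ... | inj₁ (u , eq) = inj₁ (zero , g , u) , cong₂ (λ f y → inj₂ (f , y)) (⊕-identityˡ (suc g)) eq
  ... | inj₂ (u , eq) = pairBlock suc≢zero u ,
    trans (cong (λ b → inj₂ (suc g ⊕ b , pairColour (forward (suc g) b) u)) (punchIn-punchOut suc≢zero))
          (cong₂ (λ f y → inj₂ (f , y)) (⊕-identityʳ (suc g)) eq)
    where
    suc≢zero : suc g ≢ zero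
    suc≢zero ()

  blockColour-colouring : IsClawColouring blockClaw blockColour
  blockColour-colouring = blockColour-onto , blockColour-proper

  localBlock↔ : (Fin 15 ⊎ (Fin r × Fin 13)) ↔ LocalBlock
  localBlock↔ = mk↔ₛ′ to from to∘from from∘to
    where
    to : Fin 15 ⊎ (Fin r × Fin 13) → LocalBlock
    to (inj₁ i) = zero , i
    to (inj₂ (g , i)) = suc g , i
    from : LocalBlock → Fin 15 ⊎ (Fin r × Fin 13)
    from (zero , i) = inj₁ i
    from (suc g , i) = inj₂ (g , i)
    to∘from : ∀ l → to (from l) ≡ l
    to∘from (zero , _) = refl
    to∘from (suc _ , _) = refl
    from∘to : ∀ l → from (to l) ≡ l
    from∘to (inj₁ _) = refl
    from∘to (inj₂ _) = refl

  vertex↔ : Vertex ↔ Fin (4 + suc r * 6)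
  vertex↔ = ↔-sym ((↔-id _ ⊎-↔ *↔×) ↔-∘ +↔⊎)

  colour↔ : Colour ↔ Fin (3 + suc r * 6)
  colour↔ = ↔-sym ((↔-id _ ⊎-↔ *↔×) ↔-∘ +↔⊎)

  block↔ : Fin (suc r * (r * 6) + (15 + r * 13)) ↔ Block
  block↔ = (((↔-id _ ×-↔ *↔×) ↔-∘ *↔×) ⊎-↔ (localBlock↔ ↔-∘ ((↔-id _ ⊎-↔ *↔×) ↔-∘ +↔⊎))) ↔-∘ +↔⊎

  colourableSystem : ColourableStarSystem (4 + suc r * 6) (3 + suc r * 6)
  colourableSystem = colourableStarSystem vertex↔ block↔ colour↔ blockClaw blockColour
    blockClaw-system blockColour-colouring

twelve-t+10 : ∀ t → 10 + t * 12 ≡ 4 + suc (t + t) * 6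
twelve-t+10 = solve-∀
  where open import Data.Nat.Tactic.RingSolver

theorem4p4 : (n : ℕ) → n > 0 → n % 12 ≡ 10 →
    Σ ℕ λ m → Σ (Fin m → Star n) λ B →
      IsStarSystem n m B × BlockColourable B (n ∸ 1)
theorem4p4 n _ n%12≡10 =
  subst (λ n → ColourableStarSystem n (n ∸ 1)) (sym n≡) (Construction.colourableSystem t)
  where
  t = n / 12
  n≡ : n ≡ 4 + suc (t + t) * 6
  n≡ = begin
    n               ≡⟨ m≡m%n+[m/n]*n n 12 ⟩
    n % 12 + t * 12 ≡⟨ cong (_+ t * 12) n%12≡10 ⟩
    10 + t * 12     ≡⟨ twelve-t+10 t ⟩
    4 + suc (t + t) * 6 ∎
    where open ≡-Reasoning
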